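{- Let $m$ be a deficient number, $e\ge 1$ an integer, and $p$ a prime with $\gcd(m,p)=1$. Then: (a) if $p^e/\sigma(p^{e-1})<\sigma(m)/d(m)$, then $mp^e$ is abundant; (b) if $p^e/\sigma(p^{e-1})=\sigma(m)/d(m)$, then $mp^e$ is perfect; (c) if $p^e/\sigma(p^{e-1})>\sigma(m)/d(m)$, then $mp^e$ is deficient.
   Context: For $n\in\mathbb{N}$, $\sigma(n)=\sum_{d\mid n}d$ (so $\sigma(1)=1$). $n$ is deficient if $\sigma(n)<2n$, perfect if $\sigma(n)=2n$, abundant if $\sigma(n)>2n$. The deficiency is $d(n)=2n-\sigma(n)$. -}

module Defs where

open import Data.Nat using (ℕ; zero; suc; _+_; _*_; _∸_; _<_)
open import Data.Nat.Divisibility using (_∣?_)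
open import Data.List using (List; filter; upTo)
open import Data.Nat.ListAction using (sum)
open import Data.Integer using (+_)
open import Data.Rational using (ℚ; _/_; 0ℚ)
open import Relation.Binary.PropositionalEquality using (_≡_)

-- divisors of n: the d in {0,…,n} with d ∣ n (for n ≥ 1 these are exactly the positive divisors;
-- 0 is never included for n ≥ 1 since 0 ∣ n forces n = 0)
divisors : ℕ → List ℕ
divisors n = filter (λ d → d ∣? n) (upTo (suc n))

σ : ℕ → ℕ
σ n = sum (divisors n)

Deficient : ℕ → Set
Deficient n = σ n < 2 * n

Perfect : ℕ → Set
Perfect n = σ n ≡ 2 * n

Abundant : ℕ → Set
Abundant n = 2 * n < σ n

-- deficiency d(n) = 2n - σ(n) (truncated; only used for deficient n, where it is exact)
deficiency : ℕ → ℕ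
deficiency n = 2 * n ∸ σ n

-- rational quotient a / b of naturals; only used with b > 0 (value 0 if b = 0)
_÷_ : ℕ → ℕ → ℚ
a ÷ zero = 0ℚ
a ÷ suc b = (+ a) / suc b

-- For p prime and p ∤ m, the divisors of p·(m·pᵏ) not divisible by p are exactly the divisors
-- of m, and those divisible by p are p times the divisors of m·pᵏ; so σ(m·pᵏ⁺¹) = σ(m) + p·σ(m·pᵏ),
-- whence σ(m·pᵉ) = σ(m)·σ(pᵉ) = σ(m)·(pᵉ + σ(pᵉ⁻¹)).  As 2m = σ(m) + d(m), comparing 2m·pᵉ with
-- σ(m·pᵉ) amounts to comparing pᵉ·d(m) with σ(m)·σ(pᵉ⁻¹), which is the comparison of the two
-- fractions cross-multiplied.
module Submission where

open import Defs
open import Data.Nat using (ℕ; zero; suc; _+_; _*_; _^_; _∸_; _≤_; _<_; _≥_; s≤s; z<s; s<s; >-nonZero;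
  NonZero; nonTrivial⇒≢1)
open import Data.Nat.Properties
open import Data.Nat.Divisibility
open import Data.Nat.Coprimality using (Coprime; coprime-divisor; gcd≡1⇒coprime)
open import Data.Nat.GCD using (gcd)
open import Data.Nat.Primality using (Prime; prime⇒irreducible; prime⇒nonZero; prime⇒nonTrivial)
open import Data.Nat.ListAction using (sum)
import Data.Integer as ℤ
import Data.Integer.Properties as ℤ
import Data.Rational as ℚ
open import Data.Rational.Properties using (toℚᵘ-mono-<; toℚᵘ-fromℚᵘ; fromℚᵘ-injective)
import Data.Rational.Unnormalised as ℚᵘ
import Data.Rational.Unnormalised.Properties as ℚᵘ
open import Data.List using (filter; applyUpTo)
open import Data.Product using (_×_; _,_)
open import Data.Sum using (inj₁; inj₂)
open import Function using (_∘_; id)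
open import Relation.Nullary using (Dec; yes; no; contradiction)
open import Relation.Binary.PropositionalEquality
open import Algebra.Properties.CommutativeSemigroup +-commutativeSemigroup
  using () renaming (interchange to +-interchange)
open import Algebra.Properties.CommutativeSemigroup *-commutativeSemigroup
  using () renaming (x∙yz≈y∙xz to *-leftComm)

sumTo : ℕ → (ℕ → ℕ) → ℕ
sumTo zero    f = 0
sumTo (suc n) f = f 0 + sumTo n (f ∘ suc)

sumTo-cong : ∀ n {f g} → (∀ i → f i ≡ g i) → sumTo n f ≡ sumTo n g
sumTo-cong zero    eq = refl
sumTo-cong (suc n) eq = cong₂ _+_ (eq 0) (sumTo-cong n (eq ∘ suc))

sumTo-+ : ∀ n f g → sumTo n (λ i → f i + g i) ≡ sumTo n f + sumTo n g
sumTo-+ zero    f g = refl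
sumTo-+ (suc n) f g =
  trans (cong (f 0 + g 0 +_) (sumTo-+ n (f ∘ suc) (g ∘ suc))) (+-interchange (f 0) (g 0) _ _)

sumTo-*ˡ : ∀ c n f → sumTo n (λ i → c * f i) ≡ c * sumTo n f
sumTo-*ˡ c zero    f = sym (*-zeroʳ c)
sumTo-*ˡ c (suc n) f = trans (cong (c * f 0 +_) (sumTo-*ˡ c n (f ∘ suc))) (sym (*-distribˡ-+ c (f 0) _))

sumTo-++ : ∀ a b f → sumTo (a + b) f ≡ sumTo a f + sumTo b (λ i → f (a + i))
sumTo-++ zero    b f = refl
sumTo-++ (suc a) b f = trans (cong (f 0 +_) (sumTo-++ a b (f ∘ suc))) (sym (+-assoc (f 0) _ _))

sumTo-vanishes : ∀ n f → (∀ i → i < n → f i ≡ 0) → sumTo n f ≡ 0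
sumTo-vanishes zero    f eq = refl
sumTo-vanishes (suc n) f eq =
  cong₂ _+_ (eq 0 z<s) (sumTo-vanishes n (f ∘ suc) (λ i → eq (suc i) ∘ s<s))

sumTo-extend : ∀ {a b} f → a ≤ b → (∀ i → a ≤ i → f i ≡ 0) → sumTo a f ≡ sumTo b f
sumTo-extend {a} {b} f a≤b vanish = begin
  sumTo a f                                   ≡⟨ +-identityʳ _ ⟨
  sumTo a f + 0                               ≡⟨ cong (sumTo a f +_) tail≡0 ⟨
  sumTo a f + sumTo (b ∸ a) (λ i → f (a + i)) ≡⟨ sumTo-++ a (b ∸ a) f ⟨
  sumTo (a + (b ∸ a)) f                       ≡⟨ cong (λ n → sumTo n f) (m+[n∸m]≡n a≤b) ⟩
  sumTo b f                                   ∎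
  where
  open ≡-Reasoning
  tail≡0 : sumTo (b ∸ a) (λ i → f (a + i)) ≡ 0
  tail≡0 = sumTo-vanishes (b ∸ a) _ (λ i _ → vanish (a + i) (m≤m+n a i))

when : ∀ {A : Set} → Dec A → ℕ → ℕ
when (yes _) x = x
when (no _)  _ = 0

unless : ∀ {A : Set} → Dec A → ℕ → ℕ
unless (yes _) _ = 0
unless (no _)  x = x

when+unless : ∀ {A : Set} (A? : Dec A) x → x ≡ when A? x + unless A? x
when+unless (yes _) x = sym (+-identityʳ x)
when+unless (no _)  x = refl

when-zero : ∀ {A : Set} (A? : Dec A) → when A? 0 ≡ 0
when-zero (yes _) = refl
when-zero (no _)  = refl

when-cong : ∀ {A B : Set} (A? : Dec A) (B? : Dec B) → (A → B) → (B → A) →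
  ∀ x → when A? x ≡ when B? x
when-cong (yes _) (yes _)  _   _   _ = refl
when-cong (yes a) (no ¬b)  A⇒B _   _ = contradiction (A⇒B a) ¬b
when-cong (no ¬a) (yes b)  _   B⇒A _ = contradiction (B⇒A b) ¬a
when-cong (no _)  (no _)   _   _   _ = refl

sum-filter-applyUpTo : ∀ {P : ℕ → Set} (P? : ∀ x → Dec (P x)) g n →
  sum (filter P? (applyUpTo g n)) ≡ sumTo n (λ i → when (P? (g i)) (g i))
sum-filter-applyUpTo P? g zero = refl
sum-filter-applyUpTo P? g (suc n) with P? (g 0)
... | yes _ = cong (g 0 +_) (sum-filter-applyUpTo P? (g ∘ suc) n)
... | no _  = sum-filter-applyUpTo P? (g ∘ suc) n

sumTo-multiples : ∀ p .{{_ : NonZero p}} (h : ℕ → ℕ) K →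
  sumTo (p * K) (λ d → when (p ∣? d) (h d)) ≡ sumTo K (λ j → h (p * j))
sumTo-multiples p@(suc q) h zero rewrite *-zeroʳ p = refl
sumTo-multiples p@(suc q) h (suc K) = begin
  sumTo (p * suc K) f                             ≡⟨ cong (λ n → sumTo n f) (*-suc p K) ⟩
  sumTo (p + p * K) f                             ≡⟨ sumTo-++ p (p * K) f ⟩
  sumTo p f + sumTo (p * K) (λ i → f (p + i))     ≡⟨ cong₂ _+_ first-block (sumTo-cong (p * K) shift) ⟩
  h 0 + sumTo (p * K) (λ i → when (p ∣? i) (h (p + i)))
                                                  ≡⟨ cong (h 0 +_) (sumTo-multiples p (h ∘ (p +_)) K) ⟩
  h 0 + sumTo K (λ j → h (p + p * j))
                                                  ≡⟨ cong₂ _+_ (cong h (*-zeroʳ p)) (sumTo-cong K (cong h ∘ *-suc p)) ⟨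
  sumTo (suc K) (λ j → h (p * j))                 ∎
  where
  open ≡-Reasoning
  f : ℕ → ℕ
  f d = when (p ∣? d) (h d)
  first-block : sumTo p f ≡ h 0
  first-block = trans (cong (h 0 +_) (sumTo-vanishes q (f ∘ suc) not-multiple)) (+-identityʳ (h 0))
    where
    not-multiple : ∀ i → i < q → f (suc i) ≡ 0
    not-multiple i i<q with p ∣? suc i
    ... | yes p∣1+i = contradiction p∣1+i (>⇒∤ (s<s i<q))
    ... | no _      = refl
  shift : ∀ i → f (p + i) ≡ when (p ∣? i) (h (p + i))
  shift i =
    when-cong (p ∣? (p + i)) (p ∣? i) (λ p∣p+i → ∣m+n∣m⇒∣n p∣p+i ∣-refl) (∣m∣n⇒∣m+n ∣-refl) (h (p + i))

ifDivides : ℕ → ℕ → ℕ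
ifDivides n d = when (d ∣? n) d

ifDivides-vanishes : ∀ {n d} .{{_ : NonZero n}} → n < d → ifDivides n d ≡ 0
ifDivides-vanishes {n} {d} n<d with d ∣? n
... | yes d∣n = contradiction d∣n (>⇒∤ n<d)
... | no _    = refl

ifDivides-*ˡ : ∀ p .{{_ : NonZero p}} n j → ifDivides (p * n) (p * j) ≡ p * ifDivides n j
ifDivides-*ˡ p n j with p * j ∣? p * n | j ∣? n
... | yes _     | yes _    = refl
... | yes pj∣pn | no j∤n   = contradiction (*-cancelˡ-∣ p pj∣pn) j∤n
... | no pj∤pn  | yes j∣n  = contradiction (*-monoʳ-∣ p j∣n) pj∤pn
... | no _      | no _     = sym (*-zeroʳ p)

σ≡sumTo : ∀ n → σ n ≡ sumTo (suc n) (ifDivides n)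
σ≡sumTo n = sum-filter-applyUpTo (_∣? n) id (suc n)

σ-multiplesOf : ℕ → ℕ → ℕ
σ-multiplesOf p n = sumTo (suc n) (λ d → when (p ∣? d) (ifDivides n d))

σ-nonMultiplesOf : ℕ → ℕ → ℕ
σ-nonMultiplesOf p n = sumTo (suc n) (λ d → unless (p ∣? d) (ifDivides n d))

σ-split : ∀ p n → σ n ≡ σ-nonMultiplesOf p n + σ-multiplesOf p n
σ-split p n = begin
  σ n                                              ≡⟨ σ≡sumTo n ⟩
  sumTo (suc n) (ifDivides n)                      ≡⟨ sumTo-cong (suc n) split ⟩
  sumTo (suc n) (λ d → multiple d + nonMultiple d) ≡⟨ sumTo-+ (suc n) multiple nonMultiple ⟩
  σ-multiplesOf p n + σ-nonMultiplesOf p n         ≡⟨ +-comm (σ-multiplesOf p n) _ ⟩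
  σ-nonMultiplesOf p n + σ-multiplesOf p n         ∎
  where
  open ≡-Reasoning
  multiple nonMultiple : ℕ → ℕ
  multiple    d = when (p ∣? d) (ifDivides n d)
  nonMultiple d = unless (p ∣? d) (ifDivides n d)
  split : ∀ d → ifDivides n d ≡ multiple d + nonMultiple d
  split d = when+unless (p ∣? d) (ifDivides n d)

σ-multiplesOf-*ˡ : ∀ p .{{_ : NonZero p}} n .{{_ : NonZero n}} → σ-multiplesOf p (p * n) ≡ p * σ n
σ-multiplesOf-*ˡ p@(suc _) n = begin
  sumTo (suc (p * n)) f                        ≡⟨ sumTo-extend f p*n<p*[1+n] vanish ⟩
  sumTo (p * suc n) f                          ≡⟨ sumTo-multiples p (ifDivides (p * n)) (suc n) ⟩
  sumTo (suc n) (λ j → ifDivides (p * n) (p * j)) ≡⟨ sumTo-cong (suc n) (ifDivides-*ˡ p n) ⟩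
  sumTo (suc n) (λ j → p * ifDivides n j)      ≡⟨ sumTo-*ˡ p (suc n) (ifDivides n) ⟩
  p * sumTo (suc n) (ifDivides n)              ≡⟨ cong (p *_) (σ≡sumTo n) ⟨
  p * σ n                                      ∎
  where
  open ≡-Reasoning
  instance
    p*n≢0 : NonZero (p * n)
    p*n≢0 = m*n≢0 p n
  f : ℕ → ℕ
  f d = when (p ∣? d) (ifDivides (p * n) d)
  p*n<p*[1+n] : suc (p * n) ≤ p * suc n
  p*n<p*[1+n] = *-monoʳ-< p (n<1+n n)
  vanish : ∀ i → suc (p * n) ≤ i → f i ≡ 0
  vanish i p*n<i = trans (cong (when (p ∣? i)) (ifDivides-vanishes p*n<i)) (when-zero (p ∣? i))

module _ {p : ℕ} (p-prime : Prime p) where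

  private instance
    p≢0 : NonZero p
    p≢0 = prime⇒nonZero p-prime

  ∤⇒coprime : ∀ {d} → p ∤ d → Coprime d p
  ∤⇒coprime p∤d (i∣d , i∣p) with prime⇒irreducible p-prime i∣p
  ... | inj₁ i≡1    = i≡1
  ... | inj₂ refl   = contradiction i∣d p∤d

  ∤∧∣*^⇒∣ : ∀ {d} m k → p ∤ d → d ∣ m * p ^ k → d ∣ m
  ∤∧∣*^⇒∣ {d} m zero    p∤d d∣m*1 = subst (d ∣_) (*-identityʳ m) d∣m*1
  ∤∧∣*^⇒∣ {d} m (suc k) p∤d d∣m*p^[1+k] =
    ∤∧∣*^⇒∣ m k p∤d (coprime-divisor (∤⇒coprime p∤d) d∣p*[m*p^k])
    where
    d∣p*[m*p^k] : d ∣ p * (m * p ^ k)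
    d∣p*[m*p^k] = subst (d ∣_) (*-leftComm m p (p ^ k)) d∣m*p^[1+k]

  module _ {m : ℕ} .{{_ : NonZero m}} (p∤m : p ∤ m) where

    σ-nonMultiplesOf-*^ : ∀ k → σ-nonMultiplesOf p (m * p ^ k) ≡ σ m
    σ-nonMultiplesOf-*^ k = begin
      sumTo (suc (m * p ^ k)) (λ d → unless (p ∣? d) (ifDivides (m * p ^ k) d))
                                           ≡⟨ sumTo-cong (suc (m * p ^ k)) divisor-of-m ⟩
      sumTo (suc (m * p ^ k)) (ifDivides m)
                                           ≡⟨ sumTo-extend (ifDivides m) (s≤s m≤m*p^k) (λ _ → ifDivides-vanishes) ⟨
      sumTo (suc m) (ifDivides m)           ≡⟨ σ≡sumTo m ⟨
      σ m                                   ∎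
      where
      open ≡-Reasoning
      m≤m*p^k : m ≤ m * p ^ k
      m≤m*p^k = m≤m*n m (p ^ k) {{m^n≢0 p k}}
      divisor-of-m : ∀ d → unless (p ∣? d) (ifDivides (m * p ^ k) d) ≡ ifDivides m d
      divisor-of-m d with p ∣? d
      ... | no p∤d =
        when-cong (d ∣? m * p ^ k) (d ∣? m) (∤∧∣*^⇒∣ m k p∤d) (λ d∣m → ∣-trans d∣m (m∣m*n (p ^ k))) d
      ... | yes p∣d with d ∣? m
      ...   | yes d∣m = contradiction (∣-trans p∣d d∣m) p∤m
      ...   | no _    = refl

    σ-*^-suc : ∀ k → σ (m * p ^ suc k) ≡ σ m + p * σ (m * p ^ k)
    σ-*^-suc k = trans (σ-split p (m * p ^ suc k)) (cong₂ _+_ (σ-nonMultiplesOf-*^ (suc k)) multiples)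
      where
      instance
        p^k≢0 : NonZero (p ^ k)
        p^k≢0 = m^n≢0 p k
      multiples : σ-multiplesOf p (m * p ^ suc k) ≡ p * σ (m * p ^ k)
      multiples rewrite *-leftComm m p (p ^ k) = σ-multiplesOf-*ˡ p (m * p ^ k) {{m*n≢0 m (p ^ k)}}

  p∤1 : p ∤ 1
  p∤1 = nonTrivial⇒≢1 {{prime⇒nonTrivial p-prime}} ∘ ∣1⇒≡1

  σ-^-suc : ∀ k → σ (p ^ suc k) ≡ suc (p * σ (p ^ k))
  σ-^-suc k = begin
    σ (p ^ suc k)           ≡⟨ cong σ (*-identityˡ (p ^ suc k)) ⟨
    σ (1 * p ^ suc k)       ≡⟨ σ-*^-suc p∤1 k ⟩
    suc (p * σ (1 * p ^ k)) ≡⟨ cong (λ n → suc (p * σ n)) (*-identityˡ (p ^ k)) ⟩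
    suc (p * σ (p ^ k))     ∎
    where open ≡-Reasoning

  σ-^-suc≡^+σ : ∀ k → σ (p ^ suc k) ≡ p ^ suc k + σ (p ^ k)
  σ-^-suc≡^+σ zero    = trans (σ-^-suc zero) (+-comm 1 (p * 1))
  σ-^-suc≡^+σ (suc k) = begin
    σ (p ^ suc (suc k))                          ≡⟨ σ-^-suc (suc k) ⟩
    suc (p * σ (p ^ suc k))                      ≡⟨ cong (suc ∘ (p *_)) (σ-^-suc≡^+σ k) ⟩
    suc (p * (p ^ suc k + σ (p ^ k)))            ≡⟨ cong suc (*-distribˡ-+ p (p ^ suc k) _) ⟩
    suc (p ^ suc (suc k) + p * σ (p ^ k))        ≡⟨ +-suc (p ^ suc (suc k)) _ ⟨
    p ^ suc (suc k) + suc (p * σ (p ^ k))        ≡⟨ cong (p ^ suc (suc k) +_) (σ-^-suc k) ⟨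
    p ^ suc (suc k) + σ (p ^ suc k)              ∎
    where open ≡-Reasoning

  σ-^-nonZero : ∀ k → NonZero (σ (p ^ k))
  σ-^-nonZero zero    = _
  σ-^-nonZero (suc k) = subst NonZero (sym (σ-^-suc k)) _

  σ-*^ : ∀ {m} .{{_ : NonZero m}} → p ∤ m → ∀ k → σ (m * p ^ k) ≡ σ m * σ (p ^ k)
  σ-*^ {m} p∤m zero    = trans (cong σ (*-identityʳ m)) (sym (*-identityʳ (σ m)))
  σ-*^ {m} p∤m (suc k) = begin
    σ (m * p ^ suc k)             ≡⟨ σ-*^-suc p∤m k ⟩
    σ m + p * σ (m * p ^ k)       ≡⟨ cong (λ x → σ m + p * x) (σ-*^ p∤m k) ⟩
    σ m + p * (σ m * σ (p ^ k))   ≡⟨ cong (σ m +_) (*-leftComm p (σ m) _) ⟩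
    σ m + σ m * (p * σ (p ^ k))   ≡⟨ *-suc (σ m) _ ⟨
    σ m * suc (p * σ (p ^ k))     ≡⟨ cong (σ m *_) (σ-^-suc k) ⟨
    σ m * σ (p ^ suc k)           ∎
    where open ≡-Reasoning

÷<÷⇒*<* : ∀ {a b c d} .{{_ : NonZero b}} .{{_ : NonZero d}} → a ÷ b ℚ.< c ÷ d → a * d < c * b
÷<÷⇒*<* {a} {suc b} {c} {suc d} a/b<c/d =
  ℤ.drop‿+<+ (subst₂ ℤ._<_ (sym (ℤ.pos-* a (suc d))) (sym (ℤ.pos-* c (suc b)))
                        (ℚᵘ.drop-*<* unnormalised))
  where
  unnormalised : ℚᵘ.mkℚᵘ (ℤ.+ a) b ℚᵘ.< ℚᵘ.mkℚᵘ (ℤ.+ c) d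
  unnormalised = ℚᵘ.<-respʳ-≃ (toℚᵘ-fromℚᵘ _) (ℚᵘ.<-respˡ-≃ (toℚᵘ-fromℚᵘ _) (toℚᵘ-mono-< a/b<c/d))

÷≡÷⇒*≡* : ∀ {a b c d} .{{_ : NonZero b}} .{{_ : NonZero d}} → a ÷ b ≡ c ÷ d → a * d ≡ c * b
÷≡÷⇒*≡* {a} {suc b} {c} {suc d} a/b≡c/d
  with fromℚᵘ-injective {ℚᵘ.mkℚᵘ (ℤ.+ a) b} {ℚᵘ.mkℚᵘ (ℤ.+ c) d} a/b≡c/d
... | ℚᵘ.*≡* ad≡cb = ℤ.+-injective (trans (ℤ.pos-* a (suc d)) (trans ad≡cb (sym (ℤ.pos-* c (suc b)))))

2[m*a]-vs-s*[a+b] : ∀ {m s d a b x} → 2 * m ≡ s + d → x ≡ s * (a + b) →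
  (a * d < s * b → 2 * (m * a) < x)
  × (a * d ≡ s * b → x ≡ 2 * (m * a))
  × (s * b < a * d → x < 2 * (m * a))
2[m*a]-vs-s*[a+b] {m} {s} {d} {a} {b} {x} 2m≡s+d x≡s[a+b] =
    (λ ad<sb → subst₂ _<_ (sym 2ma≡sa+ad) (sym x≡sa+sb) (+-monoʳ-< (s * a) ad<sb))
  , (λ ad≡sb → trans x≡sa+sb (trans (cong (s * a +_) (sym ad≡sb)) (sym 2ma≡sa+ad)))
  , (λ sb<ad → subst₂ _<_ (sym x≡sa+sb) (sym 2ma≡sa+ad) (+-monoʳ-< (s * a) sb<ad))
  where
  open ≡-Reasoning
  2ma≡sa+ad : 2 * (m * a) ≡ s * a + a * d
  2ma≡sa+ad = begin
    2 * (m * a)     ≡⟨ *-assoc 2 m a ⟨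
    2 * m * a       ≡⟨ cong (_* a) 2m≡s+d ⟩
    (s + d) * a     ≡⟨ *-distribʳ-+ a s d ⟩
    s * a + d * a   ≡⟨ cong (s * a +_) (*-comm d a) ⟩
    s * a + a * d   ∎
  x≡sa+sb : x ≡ s * a + s * b
  x≡sa+sb = trans x≡s[a+b] (*-distribˡ-+ s a b)

σ+deficiency≡2* : ∀ {n} → Deficient n → σ n + deficiency n ≡ 2 * n
σ+deficiency≡2* deficient = m+[n∸m]≡n (<⇒≤ deficient)

proposition2p5 : (m e p : ℕ) → Deficient m → e ≥ 1 → Prime p → gcd m p ≡ 1 →
    ((p ^ e) ÷ σ (p ^ (e ∸ 1)) ℚ.< σ m ÷ deficiency m → Abundant (m * p ^ e))
    × ((p ^ e) ÷ σ (p ^ (e ∸ 1)) ≡ σ m ÷ deficiency m → Perfect (m * p ^ e))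
    × (σ m ÷ deficiency m ℚ.< (p ^ e) ÷ σ (p ^ (e ∸ 1)) → Deficient (m * p ^ e))
proposition2p5 zero    _       _ ()
proposition2p5 (suc n) (suc k) p m-deficient _ p-prime gcd≡1 =
  let abundant , perfect , deficient =
        2[m*a]-vs-s*[a+b] {m} {σ m} {deficiency m} {p ^ suc k} {σ (p ^ k)}
          (sym (σ+deficiency≡2* {m} m-deficient)) σ[m*p^e]≡σm*[p^e+σp^k]
  in abundant ∘ ÷<÷⇒*<* , perfect ∘ ÷≡÷⇒*≡* , deficient ∘ ÷<÷⇒*<*
  where
  m = suc n
  p∤m : p ∤ m
  p∤m p∣m = nonTrivial⇒≢1 {{prime⇒nonTrivial p-prime}} (gcd≡1⇒coprime gcd≡1 (p∣m , ∣-refl))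
  σ[m*p^e]≡σm*[p^e+σp^k] : σ (m * p ^ suc k) ≡ σ m * (p ^ suc k + σ (p ^ k))
  σ[m*p^e]≡σm*[p^e+σp^k] = trans (σ-*^ p-prime p∤m (suc k)) (cong (σ m *_) (σ-^-suc≡^+σ p-prime k))
  instance
    σp^k≢0 : NonZero (σ (p ^ k))
    σp^k≢0 = σ-^-nonZero p-prime k
    deficiency≢0 : NonZero (deficiency m)
    deficiency≢0 = >-nonZero (m<n⇒0<n∸m m-deficient)
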